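{- Let $\mathcal{R}$ be an LCTRS and $s,t,u,v$ terms. If $s\approx t\ [\varphi]\xrightarrow{\sim\circ}_{\geq1}u\approx v\ [\psi]$, then for every substitution $\sigma\vDash\varphi$ with $\mathcal{D}\mathrm{om}(\sigma)=\mathcal{V}\mathrm{ar}(\varphi)$ there exists a substitution $\delta\vDash\psi$ with $\mathcal{D}\mathrm{om}(\delta)=\mathcal{V}\mathrm{ar}(\psi)$ such that $s\sigma\xrightarrow{\circ}u\delta$ and $t\sigma=v\delta$.
   Context: Logically constrained rewriting. Fix a many-sorted signature $\mathcal{F}=\mathcal{F}_{\mathrm{te}}\cup\mathcal{F}_{\mathrm{th}}$ (possibly infinite) and an infinite set $\mathcal{V}$ of sorted variables. For every sort $\iota$ of $\mathcal{F}_{\mathrm{th}}$ there is a non-empty set $\mathcal{V}\mathrm{al}_\iota\subseteq\mathcal{F}_{\mathrm{th}}$ of constants of sort $\iota$ (values); $\mathcal{V}\mathrm{al}=\bigcup_\iota\mathcal{V}\mathrm{al}_\iota$, $\mathcal{F}_{\mathrm{te}}\cap\mathcal{F}_{\mathrm{th}}\subseteq\mathcal{V}\mathrm{al}$. Logical terms are terms of $\mathcal{T}(\mathcal{F}_{\mathrm{th}},\mathcal{V})$; a fixed interpretation $\mathcal{J}$ evaluates ground logical terms to values via $[\![f(t_1,\dots,t_n)]\!]=f_{\mathcal{J}}([\![t_1]\!],\dots,[\![t_n]\!])$. Constraints are logical terms of sort $\mathsf{bool}$ (with connectives, $\Rightarrow$, equality $=$). $\varphi$ is valid if $[\![\varphi\gamma]\!]=\top$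 for all $\gamma$ mapping $\mathcal{V}\mathrm{ar}(\varphi)$ to values, satisfiable if this holds for some such $\gamma$; $\sigma\vDash\varphi$ means $\sigma(x)\in\mathcal{V}\mathrm{al}$ for $x\in\mathcal{V}\mathrm{ar}(\varphi)$ and $\varphi\sigma$ valid. A constrained rewrite rule $\rho\colon\ell\to r\ [\varphi]$: $\ell,r$ terms of the same sort, $\mathrm{root}(\ell)\in\mathcal{F}_{\mathrm{te}}\setminus\mathcal{F}_{\mathrm{th}}$, $\varphi$ a constraint; $\mathcal{LV}\mathrm{ar}(\rho)=\mathcal{V}\mathrm{ar}(\varphi)\cup(\mathcal{V}\mathrm{ar}(r)\setminus\mathcal{V}\mathrm{ar}(\ell))$. An LCTRS $\mathcal{R}$ is a set of such rules. $\sigma\vDash\rho$ means $\mathcal{D}\mathrm{om}(\sigma)=\mathcal{V}\mathrm{ar}(\ell)\cup\mathcal{V}\mathrm{ar}(r)\cup\mathcal{V}\mathrm{ar}(\varphi)$, $\sigma(x)\in\mathcal{V}\mathrm{al}$ for $x\in\mathcal{LV}\mathrm{ar}(\rho)$, $\varphi\sigma$ valid. Calculation rules: $f(x_1,\dots,x_n)\to y\ [y=f(x_1,\dots,x_n)]$ for $f\in\mathcal{F}_{\mathrm{th}}\setminus\mathcal{V}\mathrm{al}$, $y$ fresh; $\mathcal{R}_{\mathrm{rc}}$ is $\mathcal{R}$ together with them. Multi-steps on terms: $x\xrightarrow{\circ}x$; $f(s_1,\dots,s_n)\xrightarrow{\circ}f(t_1,\dots,t_n)$ if $s_i\xrightarrow{\circ}t_i$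 for all $i$; $\ell\sigma\xrightarrow{\circ}r\tau$ if $\rho\colon\ell\to r\ [\varphi]\in\mathcal{R}_{\mathrm{rc}}$, $\sigma\vDash\rho$ and $\sigma(x)\xrightarrow{\circ}\tau(x)$ for all $x\in\mathcal{D}\mathrm{om}(\sigma)$. Constrained terms: pairs $s\ [\varphi]$. $s\ [\varphi]\sim t\ [\psi]$ iff for every $\gamma\vDash\varphi$ with $\mathcal{D}\mathrm{om}(\gamma)=\mathcal{V}\mathrm{ar}(\varphi)$ there is $\delta\vDash\psi$ with $\mathcal{D}\mathrm{om}(\delta)=\mathcal{V}\mathrm{ar}(\psi)$ and $s\gamma=t\delta$, and vice versa. Multi-steps on constrained terms: $x\ [\varphi]\xrightarrow{\circ}x\ [\varphi]$; $f(s_1,\dots,s_n)\ [\varphi]\xrightarrow{\circ}f(t_1,\dots,t_n)\ [\varphi]$ if $s_i\ [\varphi]\xrightarrow{\circ}t_i\ [\varphi]$ for all $i$; $\ell\sigma\ [\varphi]\xrightarrow{\circ}r\tau\ [\varphi]$ if $\rho\colon\ell\to r\ [\psi]\in\mathcal{R}_{\mathrm{rc}}$, $\sigma(x)\in\mathcal{V}\mathrm{al}\cup\mathcal{V}\mathrm{ar}(\varphi)$ for all $x\in\mathcal{LV}\mathrm{ar}(\rho)$, $\varphi$ satisfiable, $\varphi\Rightarrow\psi\sigma$ valid, and $\sigma(x)\ [\varphi]\xrightarrow{\circ}\tau(x)\ [\varphi]$ for all $x\in\mathcal{D}\mathrm{om}(\sigma)$. $\xrightarrow{\sim\circ}={\sim}\cdot\xrightarrow{\circ}\cdot{\sim}$.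 An equation $s\approx t$ is treated as the term $\approx(s,t)$ for a fresh binary non-theory symbol $\approx$; $\xrightarrow{\sim\circ}_{\geq1}$ means all redexes contracted in the multi-step lie at positions $\geq1$, i.e. inside the left-hand side. -}

module Defs where

open import Data.List using (List; []; _∷_)
open import Data.List.Membership.Propositional using (_∈_; _∉_)
open import Data.List.Relation.Binary.Pointwise using (Pointwise)
open import Data.List.Relation.Unary.Unique.Propositional using (Unique)
open import Data.Product using (Σ; _×_; _,_)
open import Data.Sum using (_⊎_; inj₁; inj₂)
open import Relation.Nullary using (¬_)
open import Relation.Binary.PropositionalEquality using (_≡_; refl; subst; sym)

-- The carrier of the interpretation is the set of values itself
-- (J maps value symbols to values; every value denotes itself).

record Setting : Set₁ where
  field
    Sort  : Set
    Fun   : Set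
    arity : Fun → List Sort
    res   : Fun → Sort
    Te    : Fun → Set
    Th    : Fun → Set
    Val   : Fun → Set
    cover     : ∀ f → Te f ⊎ Th f
    te∩th⊆val : ∀ f → Te f → Th f → Val f
    val⊆th    : ∀ f → Val f → Th f
    val-const : ∀ f → Val f → arity f ≡ []
  ThSort : Sort → Set
  ThSort ι = Σ Fun λ f → Th f × (res f ≡ ι ⊎ ι ∈ arity f)
  field
    val-nonempty : ∀ ι → ThSort ι → Σ Fun λ v → Val v × res v ≡ ι
    V          : Set
    vsort      : V → Sort
    V-infinite : ∀ ι (xs : List V) → Σ V λ y → vsort y ≡ ι × y ∉ xs
    bool       : Sort
    true false : Fun
    true-val   : Val true
    true-sort  : res true ≡ bool
    false-val  : Val false
    false-sort : res false ≡ bool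
    true≢false : ¬ true ≡ false
    bool-vals  : ∀ v → Val v → res v ≡ bool → v ≡ true ⊎ v ≡ false
    imp        : Fun
    imp-th     : Th imp
    imp-arity  : arity imp ≡ bool ∷ bool ∷ []
    imp-res    : res imp ≡ bool
    eq         : (ι : Sort) → ThSort ι → Fun
    eq-th      : ∀ ι p → Th (eq ι p)
    eq-arity   : ∀ ι p → arity (eq ι p) ≡ ι ∷ ι ∷ []
    eq-res     : ∀ ι p → res (eq ι p) ≡ bool
    J          : Fun → List Fun → Fun
    J-sort     : ∀ f vs → Th f →
                 Pointwise (λ ι v → Val v × res v ≡ ι) (arity f) vs →
                 Val (J f vs) × res (J f vs) ≡ res f
    J-val      : ∀ v → Val v → J v [] ≡ v
    J-imp      : ∀ a b → Val a → res a ≡ bool → Val b → res b ≡ bool →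
                 (J imp (a ∷ b ∷ []) ≡ true → a ≡ true → b ≡ true) ×
                 ((a ≡ true → b ≡ true) → J imp (a ∷ b ∷ []) ≡ true)
    J-eq       : ∀ ι p a b → Val a → res a ≡ ι → Val b → res b ≡ ι →
                 (J (eq ι p) (a ∷ b ∷ []) ≡ true → a ≡ b) ×
                 (a ≡ b → J (eq ι p) (a ∷ b ∷ []) ≡ true)

module Rewriting (S : Setting) where
  open Setting S public

  mutual
    data Term : Sort → Set where
      var : (x : V) → Term (vsort x)
      app : (f : Fun) → Terms (arity f) → Term (res f)

    data Terms : List Sort → Set where
      []  : Terms []
      _∷_ : ∀ {ι ιs} → Term ι → Terms ιs → Terms (ι ∷ ιs)

  Subst : Set
  Subst = (x : V) → Term (vsort x)

  infixl 30 _⟨_⟩ _⟨_⟩*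
  infix 4 _⊢_⇉_ _⊢_⇉*_ _⊢_⇉∼≥1_ _∼_ _⊨_ _⊨ʳ_
  infix 5 _≈_[_]
  infixr 6 _⇒ᶜ_

  mutual
    _⟨_⟩ : ∀ {ι} → Term ι → Subst → Term ι
    var x    ⟨ σ ⟩ = σ x
    app f ts ⟨ σ ⟩ = app f (ts ⟨ σ ⟩*)

    _⟨_⟩* : ∀ {ιs} → Terms ιs → Subst → Terms ιs
    []       ⟨ σ ⟩* = []
    (t ∷ ts) ⟨ σ ⟩* = (t ⟨ σ ⟩) ∷ (ts ⟨ σ ⟩*)

  mutual
    data _∈V_ (x : V) : ∀ {ι} → Term ι → Set where
      here   : x ∈V var x
      inside : ∀ {f ts} → x ∈V* ts → x ∈V app f ts

    data _∈V*_ (x : V) : ∀ {ιs} → Terms ιs → Set where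
      head : ∀ {ι ιs} {t : Term ι} {ts : Terms ιs} → x ∈V t → x ∈V* (t ∷ ts)
      tail : ∀ {ι ιs} {t : Term ι} {ts : Terms ιs} → x ∈V* ts → x ∈V* (t ∷ ts)

  data IsValue : ∀ {ι} → Term ι → Set where
    value : ∀ {v ts} → Val v → IsValue (app v ts)

  mutual
    data Logical : ∀ {ι} → Term ι → Set where
      lvar : ∀ {x} → Logical (var x)
      lapp : ∀ {f ts} → Th f → Logical* ts → Logical (app f ts)

    data Logical* : ∀ {ιs} → Terms ιs → Set where
      []  : Logical* []
      _∷_ : ∀ {ι ιs} {t : Term ι} {ts : Terms ιs} →
            Logical t → Logical* ts → Logical* (t ∷ ts)

  mutual
    data Eval : ∀ {ι} → Term ι → Fun → Set where
      ev : ∀ {f ts vs} → Th f → Eval* ts vs → Eval (app f ts) (J f vs)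

    data Eval* : ∀ {ιs} → Terms ιs → List Fun → Set where
      []  : Eval* [] []
      _∷_ : ∀ {ι ιs v vs} {t : Term ι} {ts : Terms ιs} →
            Eval t v → Eval* ts vs → Eval* (t ∷ ts) (v ∷ vs)

  ValuesOn : ∀ {ι} → Term ι → Subst → Set
  ValuesOn t γ = ∀ x → x ∈V t → IsValue (γ x)

  Valid : Term bool → Set
  Valid φ = ∀ γ → ValuesOn φ γ → Eval (φ ⟨ γ ⟩) true

  Satisfiable : Term bool → Set
  Satisfiable φ = Σ Subst λ γ → ValuesOn φ γ × Eval (φ ⟨ γ ⟩) true

  _⊨_ : Subst → Term bool → Set
  σ ⊨ φ = ValuesOn φ σ × Valid (φ ⟨ σ ⟩)

  DomIs : Subst → Term bool → Set
  DomIs σ φ = ∀ x → (¬ σ x ≡ var x → x ∈V φ) × (x ∈V φ → ¬ σ x ≡ var x)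

  _⇒ᶜ_ : Term bool → Term bool → Term bool
  φ ⇒ᶜ ψ = subst Term imp-res (app imp (subst Terms (sym imp-arity) (φ ∷ (ψ ∷ []))))

  record Rule : Set where
    constructor rule
    field
      srt   : Sort
      lhs   : Term srt
      rhs   : Term srt
      guard : Term bool
  open Rule public

  VarOfRule : Rule → V → Set
  VarOfRule ρ x = x ∈V lhs ρ ⊎ (x ∈V rhs ρ ⊎ x ∈V guard ρ)

  LVar : Rule → V → Set
  LVar ρ x = x ∈V guard ρ ⊎ (x ∈V rhs ρ × ¬ x ∈V lhs ρ)

  data RootOK : ∀ {ι} → Term ι → Set where
    root : ∀ {f ts} → Te f → ¬ Th f → RootOK (app f ts)

  record LCTRS : Set₁ where
    field
      rules         : Rule → Set
      root-ok       : ∀ ρ → rules ρ → RootOK (lhs ρ)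
      guard-logical : ∀ ρ → rules ρ → Logical (guard ρ)
  open LCTRS public

  -- calculation rules  f(x₁,…,xₙ) → y [y = f(x₁,…,xₙ)]
  data VarVec : List Sort → Set where
    []  : VarVec []
    _∷_ : ∀ {ιs} (x : V) → VarVec ιs → VarVec (vsort x ∷ ιs)

  varList : ∀ {ιs} → VarVec ιs → List V
  varList []       = []
  varList (x ∷ xs) = x ∷ varList xs

  vars : ∀ {ιs} → VarVec ιs → Terms ιs
  vars []       = []
  vars (x ∷ xs) = var x ∷ vars xs

  calcRule : (f : Fun) → Th f → VarVec (arity f) → (y : V) → vsort y ≡ res f → Rule
  calcRule f th xs y p =
    rule (res f) (app f (vars xs)) (subst Term p (var y))
      (subst Term (eq-res (res f) thf)
        (app (eq (res f) thf)
          (subst Terms (sym (eq-arity (res f) thf))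
            (subst Term p (var y) ∷ (app f (vars xs) ∷ [])))))
    where
      thf : ThSort (res f)
      thf = f , th , inj₁ refl

  IsCalcRule : Rule → Set
  IsCalcRule ρ =
    Σ Fun λ f → Σ (Th f) λ th → ¬ Val f ×
    Σ (VarVec (arity f)) λ xs → Unique (varList xs) ×
    Σ V λ y → Σ (vsort y ≡ res f) λ p → y ∉ varList xs ×
    ρ ≡ calcRule f th xs y p

  Rrc : LCTRS → Rule → Set
  Rrc R ρ = rules R ρ ⊎ IsCalcRule ρ

  -- σ ⊨ ρ (the domain condition is reflected by only using σ on VarOfRule ρ)
  _⊨ʳ_ : Subst → Rule → Set
  σ ⊨ʳ ρ = (∀ x → LVar ρ x → IsValue (σ x)) × Valid (guard ρ ⟨ σ ⟩)

  mutual
    data _⊢_⇉_ (R : LCTRS) : ∀ {ι} → Term ι → Term ι → Set where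
      mvar  : ∀ {x} → R ⊢ var x ⇉ var x
      mapp  : ∀ {f ss ts} → R ⊢ ss ⇉* ts → R ⊢ app f ss ⇉ app f ts
      mrule : ∀ {ρ σ τ} → Rrc R ρ → σ ⊨ʳ ρ →
              (∀ x → VarOfRule ρ x → R ⊢ σ x ⇉ τ x) →
              R ⊢ lhs ρ ⟨ σ ⟩ ⇉ rhs ρ ⟨ τ ⟩

    data _⊢_⇉*_ (R : LCTRS) : ∀ {ιs} → Terms ιs → Terms ιs → Set where
      []  : R ⊢ [] ⇉* []
      _∷_ : ∀ {ι ιs} {s t : Term ι} {ss ts : Terms ιs} →
            R ⊢ s ⇉ t → R ⊢ ss ⇉* ts → R ⊢ (s ∷ ss) ⇉* (t ∷ ts)

  data InVarsOf (φ : Term bool) : ∀ {ι} → Term ι → Set where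
    isvar : ∀ {y} → y ∈V φ → InVarsOf φ (var y)

  mutual
    data CStep (R : LCTRS) (φ : Term bool) : ∀ {ι} → Term ι → Term ι → Set where
      cvar  : ∀ {x} → CStep R φ (var x) (var x)
      capp  : ∀ {f ss ts} → CStep* R φ ss ts → CStep R φ (app f ss) (app f ts)
      crule : ∀ {ρ σ τ} → Rrc R ρ →
              (∀ x → LVar ρ x → IsValue (σ x) ⊎ InVarsOf φ (σ x)) →
              Satisfiable φ →
              Valid (φ ⇒ᶜ (guard ρ ⟨ σ ⟩)) →
              (∀ x → VarOfRule ρ x → CStep R φ (σ x) (τ x)) →
              CStep R φ (lhs ρ ⟨ σ ⟩) (rhs ρ ⟨ τ ⟩)

    data CStep* (R : LCTRS) (φ : Term bool) : ∀ {ιs} → Terms ιs → Terms ιs → Set where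
      []  : CStep* R φ [] []
      _∷_ : ∀ {ι ιs} {s t : Term ι} {ss ts : Terms ιs} →
            CStep R φ s t → CStep* R φ ss ts → CStep* R φ (s ∷ ss) (t ∷ ts)

  record CEq (ι : Sort) : Set where
    constructor _≈_[_]
    field
      eqL : Term ι
      eqR : Term ι
      con : Term bool

  private
    Half : ∀ {ι} → Term ι → Term ι → Term bool → Term ι → Term ι → Term bool → Set
    Half s t φ u v ψ =
      ∀ γ → γ ⊨ φ → DomIs γ φ →
      Σ Subst λ δ → δ ⊨ ψ × DomIs δ ψ × s ⟨ γ ⟩ ≡ u ⟨ δ ⟩ × t ⟨ γ ⟩ ≡ v ⟨ δ ⟩

  _∼_ : ∀ {ι} → CEq ι → CEq ι → Set
  (s ≈ t [ φ ]) ∼ (u ≈ v [ ψ ]) = Half s t φ u v ψ × Half u v ψ s t φ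

  -- ≈(s,t) [φ] ⇉_{≥1} ≈(u,v) [ψ]: redexes only inside the left-hand side,
  -- so the right-hand side and the constraint are unchanged.
  EqStep≥1 : ∀ {ι} → LCTRS → CEq ι → CEq ι → Set
  EqStep≥1 R (s ≈ t [ φ ]) (u ≈ v [ ψ ]) = ψ ≡ φ × v ≡ t × CStep R φ s u

  _⊢_⇉∼≥1_ : ∀ {ι} → LCTRS → CEq ι → CEq ι → Set
  _⊢_⇉∼≥1_ {ι} R e e' =
    Σ (CEq ι) λ e₁ → Σ (CEq ι) λ e₂ → e ∼ e₁ × EqStep≥1 R e₁ e₂ × e₂ ∼ e'

-- The ∼-steps at both ends are bridged by the definition of ∼ itself, so everything
-- rests on instantiating the middle step: a constrained multi-step s [φ] ⇉ u [φ]
-- becomes an ordinary multi-step sγ ⇉ uγ under every γ ⊨ φ. At a rule step each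
-- logical variable of the rule is sent to a value or to a variable of φ, which γ turns
-- into a value; and the guard holds after instantiation by modus ponens, because
-- φ ⇒ guard is valid and φγ is a valid ground constraint.
module Submission where

open import Defs
open import Data.Product using (Σ; _×_; _,_; proj₁; proj₂)
open import Data.Sum using (_⊎_; inj₁; inj₂)
open import Data.List using (List; []; _∷_)
open import Data.List.Relation.Binary.Pointwise using (Pointwise; []; _∷_)
open import Data.Empty using (⊥-elim)
open import Relation.Nullary using (¬_)
open import Relation.Binary.PropositionalEquality
  using (_≡_; refl; sym; trans; cong; cong₂; subst; subst₂; module ≡-Reasoning)
open ≡-Reasoning

module Instantiation (S : Setting) where
  open Rewriting S

  infixl 40 _∘ˢ_

  _∘ˢ_ : Subst → Subst → Subst
  (σ ∘ˢ τ) x = σ x ⟨ τ ⟩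

  mutual
    ⟨⟩-∘ˢ : ∀ {ι} (t : Term ι) σ τ → t ⟨ σ ⟩ ⟨ τ ⟩ ≡ t ⟨ σ ∘ˢ τ ⟩
    ⟨⟩-∘ˢ (var x)    σ τ = refl
    ⟨⟩-∘ˢ (app f ts) σ τ = cong (app f) (⟨⟩*-∘ˢ ts σ τ)

    ⟨⟩*-∘ˢ : ∀ {ιs} (ts : Terms ιs) σ τ → ts ⟨ σ ⟩* ⟨ τ ⟩* ≡ ts ⟨ σ ∘ˢ τ ⟩*
    ⟨⟩*-∘ˢ []       σ τ = refl
    ⟨⟩*-∘ˢ (t ∷ ts) σ τ = cong₂ _∷_ (⟨⟩-∘ˢ t σ τ) (⟨⟩*-∘ˢ ts σ τ)

  mutual
    ∈V-⟨⟩ : ∀ {ι x} (t : Term ι) σ → x ∈V t ⟨ σ ⟩ → Σ V λ y → y ∈V t × x ∈V σ y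
    ∈V-⟨⟩ (var y)    σ x∈σy       = y , here , x∈σy
    ∈V-⟨⟩ (app f ts) σ (inside x∈) with ∈V*-⟨⟩* ts σ x∈
    ... | y , y∈ts , x∈σy = y , inside y∈ts , x∈σy

    ∈V*-⟨⟩* : ∀ {ιs x} (ts : Terms ιs) σ → x ∈V* ts ⟨ σ ⟩* → Σ V λ y → y ∈V* ts × x ∈V σ y
    ∈V*-⟨⟩* (t ∷ ts) σ (head x∈) with ∈V-⟨⟩ t σ x∈
    ... | y , y∈t , x∈σy = y , head y∈t , x∈σy
    ∈V*-⟨⟩* (t ∷ ts) σ (tail x∈) with ∈V*-⟨⟩* ts σ x∈
    ... | y , y∈ts , x∈σy = y , tail y∈ts , x∈σy

  IsValue⇒ground : ∀ {ι x} {t : Term ι} → IsValue t → ¬ x ∈V t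
  IsValue⇒ground (value {v} {ts} v∈Val) (inside x∈ts) = no-args (val-const v v∈Val) ts x∈ts
    where
      no-args : ∀ {ιs x} → ιs ≡ [] → (ts : Terms ιs) → ¬ x ∈V* ts
      no-args () (t ∷ ts) x∈

  IsValue-⟨⟩ : ∀ {ι} {t : Term ι} σ → IsValue t → IsValue (t ⟨ σ ⟩)
  IsValue-⟨⟩ σ (value v∈Val) = value v∈Val

  ValuesOn⇒ground : ∀ {ι x} {t : Term ι} {σ} → ValuesOn t σ → ¬ x ∈V t ⟨ σ ⟩
  ValuesOn⇒ground {t = t} {σ} values x∈tσ with ∈V-⟨⟩ t σ x∈tσ
  ... | y , y∈t , x∈σy = IsValue⇒ground (values y y∈t) x∈σy

  ValuesOn-∘ˢ : ∀ {ι} {t : Term ι} {σ} τ → ValuesOn t σ → ValuesOn t (σ ∘ˢ τ)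
  ValuesOn-∘ˢ τ values x x∈t = IsValue-⟨⟩ τ (values x x∈t)

  mutual
    Eval-functional : ∀ {ι v w} {t : Term ι} → Eval t v → Eval t w → v ≡ w
    Eval-functional (ev _ es) (ev _ es′) = cong (J _) (Eval*-functional es es′)

    Eval*-functional : ∀ {ιs vs ws} {ts : Terms ιs} → Eval* ts vs → Eval* ts ws → vs ≡ ws
    Eval*-functional []       []         = refl
    Eval*-functional (e ∷ es) (e′ ∷ es′) = cong₂ _∷_ (Eval-functional e e′) (Eval*-functional es es′)

  mutual
    Eval-sort : ∀ {ι v} {t : Term ι} → Eval t v → Val v × res v ≡ ι
    Eval-sort (ev {f} {ts} {vs} th es) = J-sort f vs th (Eval*-sort es)

    Eval*-sort : ∀ {ιs vs} {ts : Terms ιs} → Eval* ts vs → Pointwise (λ ι v → Val v × res v ≡ ι) ιs vs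
    Eval*-sort []       = []
    Eval*-sort (e ∷ es) = Eval-sort e ∷ Eval*-sort es

  -- The implication φ ⇒ᶜ χ is built with transports along imp-res and imp-arity;
  -- the next lemmas see through them.

  ⟨⟩-subst : ∀ {ι ι′} (p : ι ≡ ι′) (t : Term ι) σ → subst Term p t ⟨ σ ⟩ ≡ subst Term p (t ⟨ σ ⟩)
  ⟨⟩-subst refl t σ = refl

  ⟨⟩*-subst : ∀ {ιs ιs′} (p : ιs ≡ ιs′) (ts : Terms ιs) σ → subst Terms p ts ⟨ σ ⟩* ≡ subst Terms p (ts ⟨ σ ⟩*)
  ⟨⟩*-subst refl ts σ = refl

  ⇒ᶜ-⟨⟩ : ∀ φ χ σ → (φ ⇒ᶜ χ) ⟨ σ ⟩ ≡ (φ ⟨ σ ⟩ ⇒ᶜ χ ⟨ σ ⟩)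
  ⇒ᶜ-⟨⟩ φ χ σ = begin
    subst Term imp-res (app imp args) ⟨ σ ⟩      ≡⟨ ⟨⟩-subst imp-res (app imp args) σ ⟩
    subst Term imp-res (app imp (args ⟨ σ ⟩*))   ≡⟨ cong (λ as → subst Term imp-res (app imp as))
                                                         (⟨⟩*-subst (sym imp-arity) (φ ∷ χ ∷ []) σ) ⟩
    (φ ⟨ σ ⟩ ⇒ᶜ χ ⟨ σ ⟩)                          ∎
    where
      args = subst Terms (sym imp-arity) (φ ∷ χ ∷ [])

  ∈V-unsubst : ∀ {ι ι′ x} {t : Term ι} (p : ι ≡ ι′) → x ∈V subst Term p t → x ∈V t
  ∈V-unsubst refl x∈ = x∈

  Eval-unsubst : ∀ {ι ι′ w} {t : Term ι} (p : ι ≡ ι′) → Eval (subst Term p t) w → Eval t w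
  Eval-unsubst refl e = e

  ∈V-⇒ᶜ : ∀ {x} φ χ → x ∈V (φ ⇒ᶜ χ) → x ∈V φ ⊎ x ∈V χ
  ∈V-⇒ᶜ {x} φ χ x∈ with ∈V-unsubst imp-res x∈
  ... | inside x∈args = operands imp-arity x∈args
    where
      operands : ∀ {ιs} (p : ιs ≡ bool ∷ bool ∷ []) → x ∈V* subst Terms (sym p) (φ ∷ χ ∷ []) → x ∈V φ ⊎ x ∈V χ
      operands refl (head x∈φ)        = inj₁ x∈φ
      operands refl (tail (head x∈χ)) = inj₂ x∈χ

  Eval-⇒ᶜ : ∀ {w} φ χ → Eval (φ ⇒ᶜ χ) w →
            Σ Fun λ a → Σ Fun λ b → Eval φ a × Eval χ b × w ≡ J imp (a ∷ b ∷ [])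
  Eval-⇒ᶜ φ χ e with Eval-unsubst imp-res e
  ... | ev _ es = operands imp-arity es
    where
      operands : ∀ {ιs vs} (p : ιs ≡ bool ∷ bool ∷ []) → Eval* (subst Terms (sym p) (φ ∷ χ ∷ [])) vs →
                 Σ Fun λ a → Σ Fun λ b → Eval φ a × Eval χ b × J imp vs ≡ J imp (a ∷ b ∷ [])
      operands refl (eφ ∷ eχ ∷ []) = _ , _ , eφ , eχ , refl

  Eval-⇒ᶜ-mp : ∀ φ χ → Eval (φ ⇒ᶜ χ) true → Eval φ true → Eval χ true
  Eval-⇒ᶜ-mp φ χ e⇒ eφ with Eval-⇒ᶜ φ χ e⇒
  ... | a , b , eφa , eχb , true≡J = subst (Eval χ) b≡true eχb
    where
      a-val = Eval-sort eφa
      b-val = Eval-sort eχb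
      b≡true : b ≡ true
      b≡true = proj₁ (J-imp a b (proj₁ a-val) (proj₂ a-val) (proj₁ b-val) (proj₂ b-val))
                     (sym true≡J) (Eval-functional eφa eφ)

  -- γ ⊨ φ makes φγ ground, so validity of φγ says it is true under any (irrelevant) τ.
  ⊨⇒Eval : ∀ {φ γ} → γ ⊨ φ → ∀ τ → Eval (φ ⟨ γ ∘ˢ τ ⟩) true
  ⊨⇒Eval {φ} {γ} (values , valid) τ =
    subst (λ c → Eval c true) (⟨⟩-∘ˢ φ γ τ) (valid τ (λ x x∈ → ⊥-elim (ValuesOn⇒ground values x∈)))

  Valid-⇒ᶜ-⟨⟩ : ∀ {φ χ γ} → γ ⊨ φ → (∀ x → x ∈V χ → x ∈V φ) → Valid (φ ⇒ᶜ χ) → Valid (χ ⟨ γ ⟩)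
  Valid-⇒ᶜ-⟨⟩ {φ} {χ} {γ} γ⊨φ χ⊆φ valid τ _ =
    subst (λ c → Eval c true) (sym (⟨⟩-∘ˢ χ γ τ))
      (Eval-⇒ᶜ-mp (φ ⟨ γ ∘ˢ τ ⟩) (χ ⟨ γ ∘ˢ τ ⟩) φ⇒χ (⊨⇒Eval γ⊨φ τ))
    where
      values : ValuesOn (φ ⇒ᶜ χ) (γ ∘ˢ τ)
      values x x∈ with ∈V-⇒ᶜ φ χ x∈
      ... | inj₁ x∈φ = ValuesOn-∘ˢ τ (proj₁ γ⊨φ) x x∈φ
      ... | inj₂ x∈χ = ValuesOn-∘ˢ τ (proj₁ γ⊨φ) x (χ⊆φ x x∈χ)
      φ⇒χ : Eval (φ ⟨ γ ∘ˢ τ ⟩ ⇒ᶜ χ ⟨ γ ∘ˢ τ ⟩) true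
      φ⇒χ = subst (λ c → Eval c true) (⇒ᶜ-⟨⟩ φ χ (γ ∘ˢ τ)) (valid (γ ∘ˢ τ) values)

  LVarsIn : Term bool → Rule → Subst → Set
  LVarsIn φ ρ σ = ∀ x → LVar ρ x → IsValue (σ x) ⊎ InVarsOf φ (σ x)

  InVarsOf⇒IsValue : ∀ {φ γ ι} {t : Term ι} → ValuesOn φ γ → InVarsOf φ t → IsValue (t ⟨ γ ⟩)
  InVarsOf⇒IsValue values (isvar y∈φ) = values _ y∈φ

  InVarsOf⇒∈V : ∀ {φ ι x} {t : Term ι} → InVarsOf φ t → x ∈V t → x ∈V φ
  InVarsOf⇒∈V (isvar y∈φ) here = y∈φ

  LVarsIn⇒IsValue : ∀ {φ ρ σ γ} → ValuesOn φ γ → LVarsIn φ ρ σ → ∀ x → LVar ρ x → IsValue ((σ ∘ˢ γ) x)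
  LVarsIn⇒IsValue {γ = γ} values lvars x x∈ with lvars x x∈
  ... | inj₁ σx-val = IsValue-⟨⟩ γ σx-val
  ... | inj₂ σx∈φ   = InVarsOf⇒IsValue values σx∈φ

  LVarsIn⇒guard-vars : ∀ {φ ρ σ} → LVarsIn φ ρ σ → ∀ x → x ∈V guard ρ ⟨ σ ⟩ → x ∈V φ
  LVarsIn⇒guard-vars {ρ = ρ} {σ} lvars x x∈ with ∈V-⟨⟩ (guard ρ) σ x∈
  ... | y , y∈guard , x∈σy with lvars y (inj₁ y∈guard)
  ...   | inj₁ σy-val = ⊥-elim (IsValue⇒ground σy-val x∈σy)
  ...   | inj₂ σy∈φ   = InVarsOf⇒∈V σy∈φ x∈σy

  mutual
    ⇉-refl : ∀ {R ι} (t : Term ι) → R ⊢ t ⇉ t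
    ⇉-refl (var x)    = mvar
    ⇉-refl (app f ts) = mapp (⇉*-refl ts)

    ⇉*-refl : ∀ {R ιs} (ts : Terms ιs) → R ⊢ ts ⇉* ts
    ⇉*-refl []       = []
    ⇉*-refl (t ∷ ts) = ⇉-refl t ∷ ⇉*-refl ts

  mutual
    CStep⇒⇉-⟨⟩ : ∀ {R φ γ ι} {s u : Term ι} → γ ⊨ φ → CStep R φ s u → R ⊢ s ⟨ γ ⟩ ⇉ u ⟨ γ ⟩
    CStep⇒⇉-⟨⟩ {γ = γ} γ⊨φ (cvar {x}) = ⇉-refl (γ x)
    CStep⇒⇉-⟨⟩ γ⊨φ (capp steps)       = mapp (CStep*⇒⇉*-⟨⟩ γ⊨φ steps)
    CStep⇒⇉-⟨⟩ {R} {γ = γ} γ⊨φ (crule {ρ} {σ} {τ} ρ∈R lvars _ φ⇒guard steps) =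
      subst₂ (R ⊢_⇉_) (sym (⟨⟩-∘ˢ (lhs ρ) σ γ)) (sym (⟨⟩-∘ˢ (rhs ρ) τ γ))
        (mrule ρ∈R (LVarsIn⇒IsValue (proj₁ γ⊨φ) lvars , guard-valid)
          (λ x x∈ρ → CStep⇒⇉-⟨⟩ γ⊨φ (steps x x∈ρ)))
      where
        guard-valid : Valid (guard ρ ⟨ σ ∘ˢ γ ⟩)
        guard-valid = subst Valid (⟨⟩-∘ˢ (guard ρ) σ γ)
                        (Valid-⇒ᶜ-⟨⟩ γ⊨φ (LVarsIn⇒guard-vars lvars) φ⇒guard)

    CStep*⇒⇉*-⟨⟩ : ∀ {R φ γ ιs} {ss us : Terms ιs} → γ ⊨ φ → CStep* R φ ss us → R ⊢ ss ⟨ γ ⟩* ⇉* us ⟨ γ ⟩*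
    CStep*⇒⇉*-⟨⟩ γ⊨φ []             = []
    CStep*⇒⇉*-⟨⟩ γ⊨φ (step ∷ steps) = CStep⇒⇉-⟨⟩ γ⊨φ step ∷ CStep*⇒⇉*-⟨⟩ γ⊨φ steps

lemma11 : (S : Setting) → let open Rewriting S in
    (R : LCTRS) {ι : Sort} (s t u v : Term ι) (φ ψ : Term bool) →
    R ⊢ (s ≈ t [ φ ]) ⇉∼≥1 (u ≈ v [ ψ ]) →
    (σ : Subst) → σ ⊨ φ → DomIs σ φ →
    Σ Subst λ δ → δ ⊨ ψ × DomIs δ ψ × R ⊢ s ⟨ σ ⟩ ⇉ u ⟨ δ ⟩ × t ⟨ σ ⟩ ≡ v ⟨ δ ⟩
lemma11 S R s t u v φ ψ (e₁ , e₂ , (to-e₁ , _) , (refl , refl , step) , (to-e₂ , _)) σ σ⊨φ domσ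
  with to-e₁ σ σ⊨φ domσ
... | γ , γ⊨φ₁ , domγ , sσ≡s₁γ , tσ≡t₁γ with to-e₂ γ γ⊨φ₁ domγ
...   | δ , δ⊨ψ , domδ , u₁γ≡uδ , t₁γ≡vδ =
  δ , δ⊨ψ , domδ ,
  subst₂ (R ⊢_⇉_) (sym sσ≡s₁γ) u₁γ≡uδ (CStep⇒⇉-⟨⟩ γ⊨φ₁ step) ,
  trans tσ≡t₁γ t₁γ≡vδ
  where open Rewriting S
        open Instantiation S
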